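{- Let $\mathbb{F}$ be a field of characteristic $0$, $n>1$, and $\beta$ a positive integer such that $e_2(x_1,\dots,x_n)-\beta=0$ has no solution over $\mathbb{F}$ with $\bar x\in\{0,1\}^n$. If $f\in\mathbb{F}[x_1,\dots,x_n]$ is multilinear with $f(\bar x)(e_2(\bar x)-\beta)=1\pmod{\bar x^2-\bar x}$, then $\deg f=n$.
   Context: $e_2(\bar x)=\sum_{i<j}x_ix_j$. "mod $\bar x^2-\bar x$" means modulo the ideal generated by $x_i^2-x_i$. -}

module Defs where

open import Level using (Level; _⊔_) renaming (suc to lsuc)
open import Data.Nat as ℕ using (ℕ; zero; suc; _<ᵇ_)
open import Data.Bool using (Bool; true; false; if_then_else_)
open import Data.Fin using (Fin; toℕ)
open import Data.Fin.Subset using (Subset; _∪_; ⊥; ⊤; ∣_∣)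
open import Data.Vec using (Vec; []; _∷_; lookup)
open import Data.Vec.Properties using (≡-dec)
import Data.Bool.Properties as BoolP
open import Data.List using (List; []; _∷_; map; _++_)
open import Data.Product using (Σ; _×_; _,_)
open import Relation.Nullary using (¬_; yes; no)
open import Relation.Binary.PropositionalEquality using (_≡_)
open import Algebra.Bundles using (CommutativeRing)

record Field (c ℓ : Level) : Set (lsuc (c ⊔ ℓ)) where
  field
    commutativeRing : CommutativeRing c ℓ
  open CommutativeRing commutativeRing public
  field
    0≉1     : ¬ (0# ≈ 1#)
    inverse : ∀ x → ¬ (x ≈ 0#) → Σ Carrier λ y → x * y ≈ 1#

module FieldOps {c ℓ : Level} (F : Field c ℓ) where
  open Field F

  ι : ℕ → Carrier
  ι zero    = 0#
  ι (suc m) = 1# + ι m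

  CharZero : Set ℓ
  CharZero = ∀ (m : ℕ) → ¬ (m ≡ 0) → ¬ (ι m ≈ 0#)

  sumL : List Carrier → Carrier
  sumL []       = 0#
  sumL (x ∷ xs) = x + sumL xs

  ΣFin : (n : ℕ) → (Fin n → Carrier) → Carrier
  ΣFin n g = sumL (map g (Data.List.allFin n))
    where import Data.List

  bit : Bool → Carrier
  bit true  = 1#
  bit false = 0#

  e₂-eval : (n : ℕ) → (Fin n → Carrier) → Carrier
  e₂-eval n x = ΣFin n λ j → ΣFin n λ i →
    if toℕ i <ᵇ toℕ j then x i * x j else 0#

  -- Multilinear polynomials in x₁..xₙ over F: a coefficient for each
  -- monomial x_S = ∏_{i∈S} x_i, S ⊆ {1..n}.  These represent
  -- F[x₁..xₙ]/(xᵢ²-xᵢ) (every class has a unique multilinear representative).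
  ML : ℕ → Set c
  ML n = Subset n → Carrier

  allSubsets : (n : ℕ) → List (Subset n)
  allSubsets zero    = [] ∷ []
  allSubsets (suc n) = map (false ∷_) (allSubsets n) ++ map (true ∷_) (allSubsets n)

  ⟦_≟_⟧ : {n : ℕ} → Subset n → Subset n → Bool
  ⟦ A ≟ B ⟧ with ≡-dec BoolP._≟_ A B
  ... | yes _ = true
  ... | no  _ = false

  -- product modulo (xᵢ² - xᵢ): x_A · x_B ≡ x_{A∪B}
  _⊛_ : {n : ℕ} → ML n → ML n → ML n
  _⊛_ {n} f g S = sumL (map (λ A → sumL (map (λ B →
      if ⟦ A ∪ B ≟ S ⟧ then f A * g B else 0#) (allSubsets n))) (allSubsets n))

  _≋_ : {n : ℕ} → ML n → ML n → Set ℓ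
  f ≋ g = ∀ S → f S ≈ g S

  oneML : {n : ℕ} → ML n
  oneML S = if ⟦ S ≟ ⊥ ⟧ then 1# else 0#

  e₂-minus : (n : ℕ) → ℕ → ML n
  e₂-minus n β S = if ⟦ S ≟ ⊥ ⟧ then - ι β
                   else (if ∣ S ∣ ℕ.≡ᵇ 2 then 1# else 0#)

  HasDegree : {n : ℕ} → ML n → ℕ → Set ℓ
  HasDegree f d = (Σ (Subset _) λ S → (∣ S ∣ ≡ d) × ¬ (f S ≈ 0#))
                × (∀ S → ¬ (f S ≈ 0#) → ∣ S ∣ ℕ.≤ d)

{-# OPTIONS --safe #-}
-- Evaluation at 0/1 points is a ring homomorphism on multilinear polynomials, so f takes the value
-- 1/q(k) at every point with k ones, where q(k) = C(k,2) - β.  Hence f is symmetric and its top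
-- coefficient is the n-th finite difference d n = Δⁿ(1/q)(0).  Leibniz's rule applied to
-- Δ^(m+2)((1/q)·q) = 0 gives a three-term recurrence for the d m, which solves to
-- (-1)^m · d m · q(0) ∏_{j=1}^m 2q(j) = m! · U m with U a sequence of naturals, positive from m = 2 on.
-- In characteristic 0 this forces d n ≠ 0.
module Submission where

open import Defs
open import Level using (Level)
open import Data.Nat using (ℕ; _<_; NonZero)
open import Data.Bool using (Bool)
open import Data.Fin using (Fin)
open import Relation.Nullary using (¬_)

open import Function using (_∘_)
open import Data.Nat as ℕ using (zero; suc; _≤_; z≤n; s≤s; _≡ᵇ_; _!)
import Data.Nat.Properties as ℕ
open import Data.Integer as ℤ using (ℤ; +_; -[1+_])
import Data.Integer.Properties as ℤ
open import Data.Bool using (true; false; if_then_else_; _∧_; _∨_; not)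
import Data.Bool.Properties as Bool
open import Data.List using (List; []; _∷_; map; _++_)
import Data.List.Properties as List
open import Data.Vec using ([]; _∷_)
open import Data.Vec.Properties using (≡-dec)
open import Data.Fin.Subset using (Subset; _∪_; ⊥; ⊤; ∣_∣)
open import Data.Fin.Subset.Properties using (∣p∣≤n; ∣⊤∣≡n; ∣⊥∣≡0)
open import Data.Product using (_×_; _,_; proj₂)
open import Data.Maybe using (Maybe; just; nothing)
open import Relation.Nullary using (yes; no; does)
open import Relation.Binary.PropositionalEquality as ≡ using (_≡_)
open import Algebra.Bundles using (CommutativeRing; Semiring)
import Algebra.Solver.Ring
open import Algebra.Solver.Ring.AlmostCommutativeRing
  using (_-Raw-AlmostCommutative⟶_; fromCommutativeRing)

module IntegerCoefficientRingSolver {c ℓ : Level} (R : CommutativeRing c ℓ) where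
  open CommutativeRing R
  open import Algebra.Properties.Ring ring using (-‿involutive; -0#≈0#; -‿distribˡ-*; -‿distribʳ-*)
  open import Algebra.Properties.AbelianGroup +-abelianGroup using (⁻¹-∙-comm)
  open import Algebra.Properties.CommutativeSemigroup +-commutativeSemigroup using (interchange)
  open import Algebra.Properties.Semiring.Mult.TCOptimised semiring
    using (1+×; ×-homo-+; ×1-homo-*) renaming (_×_ to _×′_)
  open import Relation.Binary.Reasoning.Setoid setoid

  private
    fromℤ : ℤ → Carrier
    fromℤ (+ n)      = n ×′ 1#
    fromℤ -[1+ n ]   = - (suc n ×′ 1#)

    -‿homo : ∀ i → fromℤ (ℤ.- i) ≈ - fromℤ i
    -‿homo (+ zero)  = sym -0#≈0#
    -‿homo (+ suc n) = refl
    -‿homo -[1+ n ]  = sym (-‿involutive _)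

    ⊖-homo : ∀ m n → fromℤ (m ℤ.⊖ n) ≈ m ×′ 1# - n ×′ 1#
    ⊖-homo m zero = begin
      fromℤ (m ℤ.⊖ 0)  ≡⟨ ≡.cong fromℤ (ℤ.≤-⊖ {n = m} z≤n) ⟩
      m ×′ 1#          ≈⟨ +-identityʳ _ ⟨
      m ×′ 1# + 0#     ≈⟨ +-congˡ -0#≈0# ⟨
      m ×′ 1# - 0#     ∎
    ⊖-homo zero (suc n) = sym (+-identityˡ _)
    ⊖-homo (suc m) (suc n) = begin
      fromℤ (suc m ℤ.⊖ suc n)      ≡⟨ ≡.cong fromℤ (ℤ.[1+m]⊖[1+n]≡m⊖n m n) ⟩
      fromℤ (m ℤ.⊖ n)              ≈⟨ ⊖-homo m n ⟩
      a - b                        ≈⟨ +-identityˡ _ ⟨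
      0# + (a - b)                 ≈⟨ +-congʳ (-‿inverseʳ 1#) ⟨
      (1# - 1#) + (a - b)          ≈⟨ interchange 1# (- 1#) a (- b) ⟩
      (1# + a) + (- 1# - b)        ≈⟨ +-cong (1+× m 1#) (trans (-‿cong (1+× n 1#)) (sym (⁻¹-∙-comm 1# b))) ⟨
      suc m ×′ 1# - suc n ×′ 1#    ∎
      where a = m ×′ 1#; b = n ×′ 1#

    +-homo : ∀ i j → fromℤ (i ℤ.+ j) ≈ fromℤ i + fromℤ j
    +-homo (+ m)    (+ n)    = ×-homo-+ 1# m n
    +-homo (+ m)    -[1+ n ] = ⊖-homo m (suc n)
    +-homo -[1+ m ] (+ n)    = trans (⊖-homo n (suc m)) (+-comm _ _)
    +-homo -[1+ m ] -[1+ n ] = begin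
      fromℤ (-[1+ m ] ℤ.+ -[1+ n ])        ≡⟨ ≡.cong fromℤ (ℤ.neg-distrib-+ (+ suc m) (+ suc n)) ⟨
      fromℤ (ℤ.- (+ suc m ℤ.+ + suc n))    ≈⟨ -‿homo (+ suc m ℤ.+ + suc n) ⟩
      - fromℤ (+ suc m ℤ.+ + suc n)        ≈⟨ -‿cong (×-homo-+ 1# (suc m) (suc n)) ⟩
      - (suc m ×′ 1# + suc n ×′ 1#)        ≈⟨ ⁻¹-∙-comm _ _ ⟨
      fromℤ -[1+ m ] + fromℤ -[1+ n ]      ∎

    *-homo-+ : ∀ m j → fromℤ (+ m ℤ.* j) ≈ fromℤ (+ m) * fromℤ j
    *-homo-+ m (+ n) = begin
      fromℤ (+ m ℤ.* + n)        ≡⟨ ≡.cong fromℤ (ℤ.pos-* m n) ⟨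
      (m ℕ.* n) ×′ 1#            ≈⟨ ×1-homo-* m n ⟩
      fromℤ (+ m) * fromℤ (+ n)  ∎
    *-homo-+ m -[1+ n ] = begin
      fromℤ (+ m ℤ.* ℤ.- + suc n)        ≡⟨ ≡.cong fromℤ (ℤ.neg-distribʳ-* (+ m) (+ suc n)) ⟨
      fromℤ (ℤ.- (+ m ℤ.* + suc n))      ≈⟨ -‿homo (+ m ℤ.* + suc n) ⟩
      - fromℤ (+ m ℤ.* + suc n)          ≈⟨ -‿cong (*-homo-+ m (+ suc n)) ⟩
      - (fromℤ (+ m) * fromℤ (+ suc n))  ≈⟨ -‿distribʳ-* _ _ ⟩
      fromℤ (+ m) * fromℤ -[1+ n ]       ∎

    *-homo : ∀ i j → fromℤ (i ℤ.* j) ≈ fromℤ i * fromℤ j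
    *-homo (+ m)    j = *-homo-+ m j
    *-homo -[1+ m ] j = begin
      fromℤ (ℤ.- + suc m ℤ.* j)      ≡⟨ ≡.cong fromℤ (ℤ.neg-distribˡ-* (+ suc m) j) ⟨
      fromℤ (ℤ.- (+ suc m ℤ.* j))    ≈⟨ -‿homo (+ suc m ℤ.* j) ⟩
      - fromℤ (+ suc m ℤ.* j)        ≈⟨ -‿cong (*-homo-+ (suc m) j) ⟩
      - (fromℤ (+ suc m) * fromℤ j)  ≈⟨ -‿distribˡ-* _ _ ⟩
      fromℤ -[1+ m ] * fromℤ j       ∎

    homomorphism : ℤ.+-*-rawRing -Raw-AlmostCommutative⟶ fromCommutativeRing R
    homomorphism = record
      { ⟦_⟧    = fromℤ
      ; +-homo = +-homo
      ; *-homo = *-homo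
      ; -‿homo = -‿homo
      ; 0-homo = refl
      ; 1-homo = refl
      }

    _≟-coefficient_ : ∀ i j → Maybe (fromℤ i ≈ fromℤ j)
    i ≟-coefficient j with i ℤ.≟ j
    ... | yes ≡.refl = just refl
    ... | no _       = nothing

  open Algebra.Solver.Ring ℤ.+-*-rawRing (fromCommutativeRing R) homomorphism _≟-coefficient_ public

module FiniteDifferences {c ℓ : Level} (R : CommutativeRing c ℓ) where
  open CommutativeRing R

  Δ : (ℕ → Carrier) → ℕ → Carrier
  Δ χ k = χ (suc k) - χ k

  Δ^ : ℕ → (ℕ → Carrier) → ℕ → Carrier
  Δ^ zero    χ = χ
  Δ^ (suc m) χ = Δ (Δ^ m χ)

  Δ^-Δ : ∀ m χ k → Δ^ m (Δ χ) k ≈ Δ^ (suc m) χ k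
  Δ^-Δ zero    χ k = refl
  Δ^-Δ (suc m) χ k = +-cong (Δ^-Δ m χ (suc k)) (-‿cong (Δ^-Δ m χ k))

  Δ≈0 : ∀ (ψ : ℕ → Carrier) {c} k → ψ (suc k) ≈ c → ψ k ≈ c → Δ ψ k ≈ 0#
  Δ≈0 ψ k ψ[1+k]≈c ψ[k]≈c = trans (+-cong ψ[1+k]≈c (-‿cong ψ[k]≈c)) (-‿inverseʳ _)

  Δ^-const : ∀ m ψ c → (∀ j → j ≤ suc m → ψ j ≈ c) → Δ^ (suc m) ψ 0 ≈ 0#
  Δ^-const zero    ψ c ψ≈c = Δ≈0 ψ 0 (ψ≈c 1 (s≤s z≤n)) (ψ≈c 0 z≤n)
  Δ^-const (suc m) ψ c ψ≈c = trans (sym (Δ^-Δ (suc m) ψ 0)) (Δ^-const m (Δ ψ) 0# Δψ≈0)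
    where
    Δψ≈0 : ∀ j → j ≤ suc m → Δ ψ j ≈ 0#
    Δψ≈0 j j≤1+m = Δ≈0 ψ j (ψ≈c (suc j) (s≤s j≤1+m)) (ψ≈c j (ℕ.m≤n⇒m≤1+n j≤1+m))

-- U (m+2) = 2(m+1) U (m+1) - (m(m+1) - 2β) U m is the recurrence of the normalised differences
-- (see ι-U-recurrence); V m = U (m+1) - m U m rewrites it without subtraction, making positivity evident.
module Numerators (β : ℕ) where
  mutual
    U : ℕ → ℕ
    U zero    = 1
    U (suc m) = V m ℕ.+ m ℕ.* U m

    V : ℕ → ℕ
    V zero    = 0
    V (suc m) = suc m ℕ.* V m ℕ.+ 2 ℕ.* β ℕ.* U m

  private
    nonZero-+ : ∀ x y → .{{NonZero x}} → NonZero (x ℕ.+ y)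
    nonZero-+ (suc x) y = _

  V-nonZero : .{{NonZero β}} → ∀ m → NonZero (V (suc m))
  V-nonZero zero    = ℕ.m*n≢0 (2 ℕ.* β) 1 {{ℕ.m*n≢0 2 β}}
  V-nonZero (suc m) =
    nonZero-+ (suc (suc m) ℕ.* V (suc m)) _ {{ℕ.m*n≢0 (suc (suc m)) (V (suc m)) {{_}} {{V-nonZero m}}}}

  U-nonZero : .{{NonZero β}} → ∀ {n} → 1 < n → NonZero (U n)
  U-nonZero {suc (suc m)} (s≤s (s≤s _)) = nonZero-+ (V (suc m)) _ {{V-nonZero m}}

initialSegment : ∀ n → ℕ → Subset n
initialSegment n       zero    = ⊥
initialSegment zero    (suc k) = []
initialSegment (suc n) (suc k) = true ∷ initialSegment n k

∣initialSegment∣ : ∀ {n k} → k ≤ n → ∣ initialSegment n k ∣ ≡ k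
∣initialSegment∣ {n} z≤n       = ∣⊥∣≡0 n
∣initialSegment∣     (s≤s k≤n) = ≡.cong suc (∣initialSegment∣ k≤n)

infix 5 _⊆ᵇ_

_⊆ᵇ_ : ∀ {n} → Subset n → Subset n → Bool
[]      ⊆ᵇ []      = true
(a ∷ A) ⊆ᵇ (c ∷ x) = (not a ∨ c) ∧ (A ⊆ᵇ x)

∪-⊆ᵇ : ∀ {n} (A B x : Subset n) → A ∪ B ⊆ᵇ x ≡ (A ⊆ᵇ x) ∧ (B ⊆ᵇ x)
∪-⊆ᵇ []          []          []          = ≡.refl
∪-⊆ᵇ (false ∷ A) (false ∷ B) (c ∷ x)     = ∪-⊆ᵇ A B x
∪-⊆ᵇ (false ∷ A) (true ∷ B)  (false ∷ x) = ≡.sym (Bool.∧-zeroʳ (A ⊆ᵇ x))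
∪-⊆ᵇ (false ∷ A) (true ∷ B)  (true ∷ x)  = ∪-⊆ᵇ A B x
∪-⊆ᵇ (true ∷ A)  (b ∷ B)     (false ∷ x) = ≡.refl
∪-⊆ᵇ (true ∷ A)  (false ∷ B) (true ∷ x)  = ∪-⊆ᵇ A B x
∪-⊆ᵇ (true ∷ A)  (true ∷ B)  (true ∷ x)  = ∪-⊆ᵇ A B x

module _ {c ℓ : Level} (F : Field c ℓ) where
  open Field F
  open FieldOps F
  open FiniteDifferences commutativeRing
  open IntegerCoefficientRingSolver commutativeRing
    using (solve; _:=_; _:+_; _:*_; _:-_; :-_; con)
  open import Algebra.Definitions.RawSemiring (Semiring.rawSemiring semiring) using (_^_)
  open import Algebra.Properties.Semiring.Mult semiring
    using (×-homo-+; ×1-homo-*) renaming (_×_ to _×ᵤ_)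
  open import Algebra.Properties.CommutativeSemigroup +-commutativeSemigroup using (interchange)
  open import Relation.Binary.Reasoning.Setoid setoid

  ι≡×1 : ∀ m → ι m ≡ m ×ᵤ 1#
  ι≡×1 zero    = ≡.refl
  ι≡×1 (suc m) = ≡.cong (_+_ 1#) (ι≡×1 m)

  ι-homo-+ : ∀ m n → ι (m ℕ.+ n) ≈ ι m + ι n
  ι-homo-+ m n rewrite ι≡×1 (m ℕ.+ n) | ι≡×1 m | ι≡×1 n = ×-homo-+ 1# m n

  ι-homo-* : ∀ m n → ι (m ℕ.* n) ≈ ι m * ι n
  ι-homo-* m n rewrite ι≡×1 (m ℕ.* n) | ι≡×1 m | ι≡×1 n = ×1-homo-* m n

  ∑ : ∀ {a} {A : Set a} → List A → (A → Carrier) → Carrier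
  ∑ xs g = sumL (map g xs)

  infix 8 ∑
  syntax ∑ xs (λ x → e) = ∑[ x ∈ xs ] e

  ∑-cong : ∀ {a} {A : Set a} (xs : List A) {g h : A → Carrier} → (∀ x → g x ≈ h x) → ∑ xs g ≈ ∑ xs h
  ∑-cong []       g≈h = refl
  ∑-cong (x ∷ xs) g≈h = +-cong (g≈h x) (∑-cong xs g≈h)

  ∑-0 : ∀ {a} {A : Set a} (xs : List A) {g : A → Carrier} → (∀ x → g x ≈ 0#) → ∑ xs g ≈ 0#
  ∑-0 []       g≈0 = refl
  ∑-0 (x ∷ xs) g≈0 = trans (+-cong (g≈0 x) (∑-0 xs g≈0)) (+-identityˡ 0#)

  ∑-+ : ∀ {a} {A : Set a} (xs : List A) (g h : A → Carrier) → ∑[ x ∈ xs ] (g x + h x) ≈ ∑ xs g + ∑ xs h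
  ∑-+ []       g h = sym (+-identityˡ 0#)
  ∑-+ (x ∷ xs) g h = trans (+-congˡ (∑-+ xs g h)) (interchange _ _ _ _)

  ∑-*ˡ : ∀ {a} {A : Set a} (xs : List A) y (g : A → Carrier) → y * ∑ xs g ≈ ∑[ x ∈ xs ] (y * g x)
  ∑-*ˡ []       y g = zeroʳ y
  ∑-*ˡ (x ∷ xs) y g = trans (distribˡ y _ _) (+-congˡ (∑-*ˡ xs y g))

  ∑-*ʳ : ∀ {a} {A : Set a} (xs : List A) y (g : A → Carrier) → ∑ xs g * y ≈ ∑[ x ∈ xs ] (g x * y)
  ∑-*ʳ []       y g = zeroˡ y
  ∑-*ʳ (x ∷ xs) y g = trans (distribʳ y _ _) (+-congˡ (∑-*ʳ xs y g))

  ∑-++ : ∀ {a} {A : Set a} (xs ys : List A) (g : A → Carrier) → ∑ (xs ++ ys) g ≈ ∑ xs g + ∑ ys g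
  ∑-++ []       ys g = sym (+-identityˡ _)
  ∑-++ (x ∷ xs) ys g = trans (+-congˡ (∑-++ xs ys g)) (sym (+-assoc _ _ _))

  ∑-map : ∀ {a b} {A : Set a} {B : Set b} (h : B → A) (ys : List B) (g : A → Carrier) → ∑ (map h ys) g ≡ ∑ ys (g ∘ h)
  ∑-map h ys g = ≡.cong sumL (≡.sym (List.map-∘ ys))

  ∑-comm : ∀ {a b} {A : Set a} {B : Set b} (xs : List A) (ys : List B) (h : A → B → Carrier) →
           ∑[ x ∈ xs ] ∑[ y ∈ ys ] h x y ≈ ∑[ y ∈ ys ] ∑[ x ∈ xs ] h x y
  ∑-comm []       ys h = sym (∑-0 ys (λ _ → refl))
  ∑-comm (x ∷ xs) ys h = trans (+-congˡ (∑-comm xs ys h)) (sym (∑-+ ys (h x) _))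

  infix 8 [_]·_

  [_]·_ : Bool → Carrier → Carrier
  [ b ]· y = if b then y else 0#

  [·]-cong : ∀ b {y z} → y ≈ z → [ b ]· y ≈ [ b ]· z
  [·]-cong true  y≈z = y≈z
  [·]-cong false _   = refl

  [·]-0 : ∀ b → [ b ]· 0# ≈ 0#
  [·]-0 true  = refl
  [·]-0 false = refl

  [·]-∑ : ∀ {a} {A : Set a} b (xs : List A) (g : A → Carrier) → [ b ]· ∑ xs g ≈ ∑[ x ∈ xs ] [ b ]· g x
  [·]-∑ true  xs g = refl
  [·]-∑ false xs g = sym (∑-0 xs (λ _ → refl))

  [·]-comm : ∀ a b y → [ a ]· [ b ]· y ≡ [ b ]· [ a ]· y
  [·]-comm true  b     y = ≡.refl
  [·]-comm false true  y = ≡.refl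
  [·]-comm false false y = ≡.refl

  [∧]· : ∀ a b y → [ a ∧ b ]· y ≡ [ a ]· [ b ]· y
  [∧]· true  b y = ≡.refl
  [∧]· false b y = ≡.refl

  [∧]·-* : ∀ a b y z → [ a ∧ b ]· (y * z) ≈ [ a ]· y * [ b ]· z
  [∧]·-* true  true  y z = refl
  [∧]·-* true  false y z = sym (zeroʳ y)
  [∧]·-* false b     y z = sym (zeroˡ _)

  ∑-allSubsets-suc : ∀ {n} (g : Subset (suc n) → Carrier) →
    ∑ (allSubsets (suc n)) g ≈ ∑[ S ∈ allSubsets n ] g (false ∷ S) + ∑[ S ∈ allSubsets n ] g (true ∷ S)
  ∑-allSubsets-suc {n} g = begin
    ∑ (map (false ∷_) (allSubsets n) ++ map (true ∷_) (allSubsets n)) g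
      ≈⟨ ∑-++ (map (false ∷_) (allSubsets n)) _ g ⟩
    ∑ (map (false ∷_) (allSubsets n)) g + ∑ (map (true ∷_) (allSubsets n)) g
      ≡⟨ ≡.cong₂ _+_ (∑-map (false ∷_) (allSubsets n) g) (∑-map (true ∷_) (allSubsets n) g) ⟩
    ∑[ S ∈ allSubsets n ] g (false ∷ S) + ∑[ S ∈ allSubsets n ] g (true ∷ S) ∎

  ⟦≟⟧≡does : ∀ {n} (A B : Subset n) → ⟦ A ≟ B ⟧ ≡ does (≡-dec Bool._≟_ A B)
  ⟦≟⟧≡does A B with ≡-dec Bool._≟_ A B
  ... | yes _ = ≡.refl
  ... | no  _ = ≡.refl

  ⟦∷≟∷⟧ : ∀ {n} a b (A B : Subset n) → ⟦ a ∷ A ≟ b ∷ B ⟧ ≡ does (a Bool.≟ b) ∧ ⟦ A ≟ B ⟧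
  ⟦∷≟∷⟧ a b A B = ≡.trans (⟦≟⟧≡does (a ∷ A) (b ∷ B)) (≡.cong (does (a Bool.≟ b) ∧_) (≡.sym (⟦≟⟧≡does A B)))

  ⟦≟⊥⟧ : ∀ {n} (S : Subset n) → ⟦ S ≟ ⊥ ⟧ ≡ (∣ S ∣ ≡ᵇ 0)
  ⟦≟⊥⟧ []          = ⟦≟⟧≡does [] []
  ⟦≟⊥⟧ (false ∷ S) = ≡.trans (⟦∷≟∷⟧ false false S ⊥) (⟦≟⊥⟧ S)
  ⟦≟⊥⟧ (true ∷ S)  = ⟦∷≟∷⟧ true false S ⊥

  ∑-δ : ∀ {n} (T : Subset n) (h : Subset n → Carrier) → ∑[ S ∈ allSubsets n ] [ ⟦ T ≟ S ⟧ ]· h S ≈ h T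
  ∑-δ []      h = +-identityʳ (h [])
  ∑-δ {suc n} (t ∷ T) h = begin
    ∑[ S ∈ allSubsets (suc n) ] [ ⟦ t ∷ T ≟ S ⟧ ]· h S
      ≈⟨ ∑-allSubsets-suc (λ S → [ ⟦ t ∷ T ≟ S ⟧ ]· h S) ⟩
    ∑[ S ∈ allSubsets n ] [ ⟦ t ∷ T ≟ false ∷ S ⟧ ]· h (false ∷ S)
      + ∑[ S ∈ allSubsets n ] [ ⟦ t ∷ T ≟ true ∷ S ⟧ ]· h (true ∷ S)
      ≈⟨ +-cong (head≈ false) (head≈ true) ⟩
    [ does (t Bool.≟ false) ]· h (false ∷ T) + [ does (t Bool.≟ true) ]· h (true ∷ T)
      ≈⟨ select t ⟩
    h (t ∷ T) ∎
    where
    head≈ : ∀ b → ∑[ S ∈ allSubsets n ] [ ⟦ t ∷ T ≟ b ∷ S ⟧ ]· h (b ∷ S) ≈ [ does (t Bool.≟ b) ]· h (b ∷ T)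
    head≈ b = begin
      ∑[ S ∈ allSubsets n ] [ ⟦ t ∷ T ≟ b ∷ S ⟧ ]· h (b ∷ S)
        ≈⟨ ∑-cong (allSubsets n) (λ S → reflexive (≡.trans (≡.cong (λ e → [ e ]· h (b ∷ S)) (⟦∷≟∷⟧ t b T S))
                                                          ([∧]· (does (t Bool.≟ b)) _ _))) ⟩
      ∑[ S ∈ allSubsets n ] [ does (t Bool.≟ b) ]· [ ⟦ T ≟ S ⟧ ]· h (b ∷ S)
        ≈⟨ [·]-∑ (does (t Bool.≟ b)) (allSubsets n) _ ⟨
      [ does (t Bool.≟ b) ]· ∑[ S ∈ allSubsets n ] [ ⟦ T ≟ S ⟧ ]· h (b ∷ S)
        ≈⟨ [·]-cong (does (t Bool.≟ b)) (∑-δ T (h ∘ (b ∷_))) ⟩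
      [ does (t Bool.≟ b) ]· h (b ∷ T) ∎
    select : ∀ t → [ does (t Bool.≟ false) ]· h (false ∷ T) + [ does (t Bool.≟ true) ]· h (true ∷ T) ≈ h (t ∷ T)
    select false = +-identityʳ _
    select true  = +-identityˡ _

  -- A 0/1 point is given by its set x of coordinates equal to 1; the monomial x_A is 1 there iff A ⊆ x.
  eval : ∀ {n} → ML n → Subset n → Carrier
  eval {n} f x = ∑[ A ∈ allSubsets n ] [ A ⊆ᵇ x ]· f A

  eval-cong : ∀ {n} {f g : ML n} → f ≋ g → ∀ x → eval f x ≈ eval g x
  eval-cong {n} f≋g x = ∑-cong (allSubsets n) (λ A → [·]-cong (A ⊆ᵇ x) (f≋g A))

  eval-⊛ : ∀ {n} (f g : ML n) x → eval (f ⊛ g) x ≈ eval f x * eval g x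
  eval-⊛ {n} f g x = begin
    ∑[ S ∈ L ] [ S ⊆ᵇ x ]· ∑[ A ∈ L ] ∑[ B ∈ L ] [ ⟦ A ∪ B ≟ S ⟧ ]· (f A * g B)
      ≈⟨ ∑-cong L (λ S → trans ([·]-∑ (S ⊆ᵇ x) L _) (∑-cong L (λ A → [·]-∑ (S ⊆ᵇ x) L _))) ⟩
    ∑[ S ∈ L ] ∑[ A ∈ L ] ∑[ B ∈ L ] [ S ⊆ᵇ x ]· [ ⟦ A ∪ B ≟ S ⟧ ]· (f A * g B)
      ≈⟨ trans (∑-comm L L _) (∑-cong L (λ A → ∑-comm L L _)) ⟩
    ∑[ A ∈ L ] ∑[ B ∈ L ] ∑[ S ∈ L ] [ S ⊆ᵇ x ]· [ ⟦ A ∪ B ≟ S ⟧ ]· (f A * g B)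
      ≈⟨ ∑-cong L (λ A → ∑-cong L (λ B → trans
           (∑-cong L (λ S → reflexive ([·]-comm (S ⊆ᵇ x) ⟦ A ∪ B ≟ S ⟧ (f A * g B))))
           (∑-δ (A ∪ B) (λ S → [ S ⊆ᵇ x ]· (f A * g B))))) ⟩
    ∑[ A ∈ L ] ∑[ B ∈ L ] [ A ∪ B ⊆ᵇ x ]· (f A * g B)
      ≈⟨ ∑-cong L (λ A → ∑-cong L (λ B → trans
           (reflexive (≡.cong (λ e → [ e ]· (f A * g B)) (∪-⊆ᵇ A B x)))
           ([∧]·-* (A ⊆ᵇ x) (B ⊆ᵇ x) (f A) (g B)))) ⟩
    ∑[ A ∈ L ] ∑[ B ∈ L ] ([ A ⊆ᵇ x ]· f A * [ B ⊆ᵇ x ]· g B)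
      ≈⟨ ∑-cong L (λ A → ∑-*ˡ L ([ A ⊆ᵇ x ]· f A) _) ⟨
    ∑[ A ∈ L ] ([ A ⊆ᵇ x ]· f A * eval g x)
      ≈⟨ ∑-*ʳ L (eval g x) _ ⟨
    eval f x * eval g x ∎
    where L = allSubsets n

  eval-[] : ∀ (f : ML 0) → eval f [] ≈ f []
  eval-[] f = +-identityʳ (f [])

  eval-false∷ : ∀ {n} (f : ML (suc n)) x → eval f (false ∷ x) ≈ eval (f ∘ (false ∷_)) x
  eval-false∷ {n} f x = begin
    eval f (false ∷ x)                    ≈⟨ ∑-allSubsets-suc (λ A → [ A ⊆ᵇ (false ∷ x) ]· f A) ⟩
    eval (f ∘ (false ∷_)) x + _           ≈⟨ +-congˡ (∑-0 (allSubsets n) (λ _ → refl)) ⟩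
    eval (f ∘ (false ∷_)) x + 0#          ≈⟨ +-identityʳ _ ⟩
    eval (f ∘ (false ∷_)) x               ∎

  eval-true∷ : ∀ {n} (f : ML (suc n)) x → eval f (true ∷ x) ≈ eval (f ∘ (false ∷_)) x + eval (f ∘ (true ∷_)) x
  eval-true∷ f x = ∑-allSubsets-suc (λ A → [ A ⊆ᵇ (true ∷ x) ]· f A)

  eval-0 : ∀ {n} (x : Subset n) → eval (λ _ → 0#) x ≈ 0#
  eval-0 {n} x = ∑-0 (allSubsets n) (λ A → [·]-0 (A ⊆ᵇ x))

  symmetric : ∀ {n} → (ℕ → Carrier) → ML n
  symmetric a S = a ∣ S ∣

  elementary : ∀ {n} → ℕ → ML n
  elementary k = symmetric (λ j → [ j ≡ᵇ k ]· 1#)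

  eval-elementary-0 : ∀ {n} (x : Subset n) → eval (elementary 0) x ≈ 1#
  eval-elementary-0 []          = eval-[] (elementary 0)
  eval-elementary-0 (false ∷ x) = trans (eval-false∷ (elementary 0) x) (eval-elementary-0 x)
  eval-elementary-0 (true ∷ x)  = begin
    eval (elementary 0) (true ∷ x)             ≈⟨ eval-true∷ (elementary 0) x ⟩
    eval (elementary 0) x + eval (λ _ → 0#) x  ≈⟨ +-cong (eval-elementary-0 x) (eval-0 x) ⟩
    1# + 0#                                    ≈⟨ +-identityʳ 1# ⟩
    1#                                         ∎

  eval-elementary-1 : ∀ {n} (x : Subset n) → eval (elementary 1) x ≈ ι ∣ x ∣
  eval-elementary-1 []          = eval-[] (elementary 1)
  eval-elementary-1 (false ∷ x) = trans (eval-false∷ (elementary 1) x) (eval-elementary-1 x)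
  eval-elementary-1 (true ∷ x)  = begin
    eval (elementary 1) (true ∷ x)                 ≈⟨ eval-true∷ (elementary 1) x ⟩
    eval (elementary 1) x + eval (elementary 0) x  ≈⟨ +-cong (eval-elementary-1 x) (eval-elementary-0 x) ⟩
    ι ∣ x ∣ + 1#                                   ≈⟨ +-comm _ 1# ⟩
    ι (suc ∣ x ∣)                                  ∎

  eval-oneML : ∀ {n} (x : Subset n) → eval oneML x ≈ 1#
  eval-oneML x = trans (eval-cong oneML≋e₀ x) (eval-elementary-0 x)
    where
    oneML≋e₀ : oneML ≋ elementary 0
    oneML≋e₀ S = reflexive (≡.cong (λ b → [ b ]· 1#) (⟦≟⊥⟧ S))

  top-coefficient : ∀ n (f : ML n) (χ : ℕ → Carrier) → (∀ x → eval f x ≈ χ ∣ x ∣) → f ⊤ ≈ Δ^ n χ 0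
  top-coefficient zero    f χ eval≈χ = trans (sym (eval-[] f)) (eval≈χ [])
  top-coefficient (suc n) f χ eval≈χ = trans (top-coefficient n f₁ (Δ χ) eval₁≈Δχ) (Δ^-Δ n χ 0)
    where
    f₀ f₁ : ML n
    f₀ = f ∘ (false ∷_)
    f₁ = f ∘ (true ∷_)
    eval₁≈Δχ : ∀ x → eval f₁ x ≈ Δ χ ∣ x ∣
    eval₁≈Δχ x = begin
      eval f₁ x                               ≈⟨ solve 2 (λ a b → b := a :+ b :- a) refl (eval f₀ x) (eval f₁ x) ⟩
      eval f₀ x + eval f₁ x - eval f₀ x       ≈⟨ +-cong (eval-true∷ f x) (-‿cong (eval-false∷ f x)) ⟨
      eval f (true ∷ x) - eval f (false ∷ x)  ≈⟨ +-cong (eval≈χ (true ∷ x)) (-‿cong (eval≈χ (false ∷ x))) ⟩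
      Δ χ ∣ x ∣                               ∎

  two : Carrier
  two = 1# + 1#

  C₂ : ℕ → Carrier
  C₂ zero    = 0#
  C₂ (suc k) = C₂ k + ι k

  C₂-double : ∀ k → two * C₂ (suc k) ≈ ι (suc k) * ι k
  C₂-double zero    =
    solve 0 (con (+ 2) :* (con (+ 0) :+ con (+ 0)) := (con (+ 1) :+ con (+ 0)) :* con (+ 0)) refl
  C₂-double (suc k) = begin
    two * (C₂ (suc k) + ι (suc k))      ≈⟨ distribˡ two _ _ ⟩
    two * C₂ (suc k) + two * ι (suc k)  ≈⟨ +-congʳ (C₂-double k) ⟩
    ι (suc k) * ι k + two * ι (suc k)
      ≈⟨ solve 1 (λ t → let one = con (+ 1) in
                   (one :+ t) :* t :+ con (+ 2) :* (one :+ t) := (one :+ (one :+ t)) :* (one :+ t))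
                 refl (ι k) ⟩
    ι (suc (suc k)) * ι (suc k)         ∎

  inverse-unique : ∀ {a b x} → a * x ≈ 1# → b * x ≈ 1# → a ≈ b
  inverse-unique {a} {b} {x} ax≈1 bx≈1 = begin
    a             ≈⟨ *-identityʳ a ⟨
    a * 1#        ≈⟨ *-congˡ bx≈1 ⟨
    a * (b * x)   ≈⟨ solve 3 (λ a b x → a :* (b :* x) := b :* (a :* x)) refl a b x ⟩
    b * (a * x)   ≈⟨ *-congˡ ax≈1 ⟩
    b * 1#        ≈⟨ *-identityʳ b ⟩
    b             ∎

  module _ (β : ℕ) where
    open Numerators β

    q : ℕ → Carrier
    q k = C₂ k - ι β

    eval-e₂-minus : ∀ {n} (x : Subset n) → eval (e₂-minus n β) x ≈ q ∣ x ∣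
    eval-e₂-minus x = trans (eval-cong e₂-minus≋ x) (eval-symmetric x)
      where
      coefficient : ℕ → Carrier
      coefficient j = if j ≡ᵇ 0 then - ι β else [ j ≡ᵇ 2 ]· 1#
      e₂-minus≋ : ∀ {n} → e₂-minus n β ≋ symmetric coefficient
      e₂-minus≋ S = reflexive (≡.cong (λ b → if b then - ι β else [ ∣ S ∣ ≡ᵇ 2 ]· 1#) (⟦≟⊥⟧ S))
      eval-symmetric : ∀ {n} (x : Subset n) → eval (symmetric coefficient) x ≈ q ∣ x ∣
      eval-symmetric []          = trans (eval-[] (symmetric coefficient)) (sym (+-identityˡ _))
      eval-symmetric (false ∷ x) = trans (eval-false∷ (symmetric coefficient) x) (eval-symmetric x)
      eval-symmetric (true ∷ x)  = begin
        eval (symmetric coefficient) (true ∷ x)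
          ≈⟨ eval-true∷ (symmetric coefficient) x ⟩
        eval (symmetric coefficient) x + eval (elementary 1) x
          ≈⟨ +-cong (eval-symmetric x) (eval-elementary-1 x) ⟩
        (C₂ ∣ x ∣ - ι β) + ι ∣ x ∣
          ≈⟨ solve 3 (λ c b t → c :- b :+ t := c :+ t :- b) refl (C₂ ∣ x ∣) (ι β) (ι ∣ x ∣) ⟩
        q (suc ∣ x ∣) ∎

    q-double : ∀ k → two * q (suc k) ≈ ι (suc k) * ι k - two * ι β
    q-double k = begin
      two * (C₂ (suc k) - ι β)
        ≈⟨ solve 2 (λ c b → con (+ 2) :* (c :- b) := con (+ 2) :* c :- con (+ 2) :* b) refl (C₂ (suc k)) (ι β) ⟩
      two * C₂ (suc k) - two * ι β  ≈⟨ +-congʳ (C₂-double k) ⟩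
      ι (suc k) * ι k - two * ι β   ∎

    -- Leibniz's rule has only three terms because Δ q k = ι k and Δ² q = 1; the index j = m + k
    -- is passed separately so that both induction steps stay definitional.
    Δ^-*q : ∀ (χ : ℕ → Carrier) m k {j} → j ≡ m ℕ.+ k →
      Δ^ (suc (suc m)) (λ i → χ i * q i) k ≈
        q (suc (suc j)) * Δ^ (suc (suc m)) χ k + ι (suc (suc m)) * ι (suc j) * Δ^ (suc m) χ k
          + C₂ (suc (suc m)) * Δ^ m χ k
    Δ^-*q χ zero k ≡.refl =
      solve 6 (λ c t b x₀ x₁ x₂ →
          let one = con (+ 1); zero = con (+ 0)
              q₀ = c :- b; q₁ = c :+ t :- b; q₂ = c :+ t :+ (one :+ t) :- b
          in x₂ :* q₂ :- x₁ :* q₁ :- (x₁ :* q₁ :- x₀ :* q₀)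
             := q₂ :* (x₂ :- x₁ :- (x₁ :- x₀)) :+ (one :+ (one :+ zero)) :* (one :+ t) :* (x₁ :- x₀)
                :+ (zero :+ zero :+ (one :+ zero)) :* x₀)
        refl (C₂ k) (ι k) (ι β) (χ k) (χ (suc k)) (χ (suc (suc k)))
    Δ^-*q χ (suc m) k ≡.refl =
      trans (+-cong (Δ^-*q χ m (suc k) (≡.sym (ℕ.+-suc m k))) (-‿cong (Δ^-*q χ m k ≡.refl)))
        (solve 9 (λ c b r s γ z₀ z₁ z₂ z₃ →
            let one = con (+ 1)
                p = one :+ (one :+ s)
                Q = c :- b; Q′ = c :+ (one :+ (one :+ r)) :- b
                y₀ = z₁ :- z₀; y₁ = z₂ :- z₁; y₂ = z₃ :- z₂
                x₀ = y₁ :- y₀; x₁ = y₂ :- y₁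
            in Q′ :* x₁ :+ p :* (one :+ (one :+ r)) :* y₁ :+ γ :* z₁ :- (Q :* x₀ :+ p :* (one :+ r) :* y₀ :+ γ :* z₀)
               := Q′ :* (x₁ :- x₀) :+ (one :+ p) :* (one :+ (one :+ r)) :* x₀ :+ (γ :+ p) :* y₀)
          refl (C₂ (suc (suc (m ℕ.+ k)))) (ι β) (ι (m ℕ.+ k)) (ι m) (C₂ (suc (suc m)))
               (Δ^ m χ k) (Δ^ m χ (suc k)) (Δ^ m χ (suc (suc k))) (Δ^ m χ (suc (suc (suc k)))))

    Den : ℕ → Carrier
    Den zero    = q 0
    Den (suc m) = two * q (suc m) * Den m

    ι-U-suc : ∀ m → ι (U (suc m)) ≈ ι (V m) + ι m * ι (U m)
    ι-U-suc m = trans (ι-homo-+ (V m) (m ℕ.* U m)) (+-congˡ (ι-homo-* m (U m)))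

    ι-V-suc : ∀ m → ι (V (suc m)) ≈ ι (suc m) * ι (V m) + ι 2 * ι β * ι (U m)
    ι-V-suc m = trans (ι-homo-+ (suc m ℕ.* V m) (2 ℕ.* β ℕ.* U m))
      (+-cong (ι-homo-* (suc m) (V m)) (trans (ι-homo-* (2 ℕ.* β) (U m)) (*-congʳ (ι-homo-* 2 β))))

    ι-U-recurrence : ∀ m → ι (U (suc (suc m))) ≈ two * ι (suc m) * ι (U (suc m)) - two * q (suc m) * ι (U m)
    ι-U-recurrence m = begin
      ι (U (suc (suc m)))                                  ≈⟨ ι-U-suc (suc m) ⟩
      ι (V (suc m)) + ι (suc m) * ι (U (suc m))            ≈⟨ +-cong (ι-V-suc m) (*-congˡ (ι-U-suc m)) ⟩
      ι (suc m) * v + ι 2 * ι β * u + ι (suc m) * (v + ι m * u)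
        ≈⟨ solve 4 (λ s v u b →
             let one = con (+ 1); p = one :+ s
             in p :* v :+ (one :+ (one :+ con (+ 0))) :* b :* u :+ p :* (v :+ s :* u)
                := con (+ 2) :* p :* (v :+ s :* u) :- (p :* s :- con (+ 2) :* b) :* u)
           refl (ι m) v u (ι β) ⟩
      two * ι (suc m) * (v + ι m * u) - (ι (suc m) * ι m - two * ι β) * u
        ≈⟨ +-cong (*-congˡ (ι-U-suc m)) (-‿cong (*-congʳ (q-double m))) ⟨
      two * ι (suc m) * ι (U (suc m)) - two * q (suc m) * ι (U m) ∎
      where
      u = ι (U m)
      v = ι (V m)

    module _ {n : ℕ} {χ : ℕ → Carrier} (χq≈1 : ∀ k → k ≤ n → χ k * q k ≈ 1#) where

      d : ℕ → Carrier
      d m = Δ^ m χ 0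

      q₁d₁≈0 : 1 ≤ n → q 1 * d 1 ≈ 0#
      q₁d₁≈0 1≤n = begin
        q 1 * (χ 1 - χ 0)       ≈⟨ solve 3 (λ b x₀ x₁ → let zero = con (+ 0) in
                                      (zero :+ zero :- b) :* (x₁ :- x₀) := x₁ :* (zero :+ zero :- b) :- x₀ :* (zero :- b))
                                    refl (ι β) (χ 0) (χ 1) ⟩
        χ 1 * q 1 - χ 0 * q 0   ≈⟨ Δ^-const 0 (λ i → χ i * q i) 1# (λ j j≤1 → χq≈1 j (ℕ.≤-trans j≤1 1≤n)) ⟩
        0#                      ∎

      recurrence : ∀ m → suc (suc m) ≤ n →
        q (suc (suc m)) * d (suc (suc m)) + ι (suc (suc m)) * ι (suc m) * d (suc m) + C₂ (suc (suc m)) * d m ≈ 0#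
      recurrence m 2+m≤n = trans (sym (Δ^-*q χ m 0 (≡.sym (ℕ.+-identityʳ m))))
        (Δ^-const (suc m) (λ i → χ i * q i) 1# (λ j j≤2+m → χq≈1 j (ℕ.≤-trans j≤2+m 2+m≤n)))

      normalised : ℕ → Carrier
      normalised m = (- 1#) ^ m * (d m * Den m)

      normalised-recurrence : ∀ m → suc (suc m) ≤ n →
        normalised (suc (suc m)) ≈
          ι (suc (suc m)) * ι (suc m) * (two * normalised (suc m) - two * q (suc m) * normalised m)
      normalised-recurrence m 2+m≤n = begin
        normalised (suc (suc m))
          ≈⟨ solve 10 (λ s D₀ q₁ q₂ p₁ p₂ γ d₀ d₁ d₂ →
               let two = con (+ 2); D₁ = two :* q₁ :* D₀; e₀ = s :* (d₀ :* D₀); e₁ = (:- con (+ 1) :* s) :* (d₁ :* D₁) in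
               (:- con (+ 1) :* (:- con (+ 1) :* s)) :* (d₂ :* (two :* q₂ :* D₁))
               := two :* s :* D₁ :* (q₂ :* d₂ :+ p₂ :* p₁ :* d₁ :+ γ :* d₀)
                  :+ (two :* p₂ :* p₁ :* e₁ :- two :* γ :* (two :* q₁) :* e₀))
             refl ((- 1#) ^ m) (Den m) q₁ q₂ p₁ p₂ γ (d m) (d (suc m)) (d (suc (suc m))) ⟩
        two * (- 1#) ^ m * Den (suc m) * (q₂ * d (suc (suc m)) + p₂ * p₁ * d (suc m) + γ * d m)
          + (two * p₂ * p₁ * e₁ - two * γ * (two * q₁) * e₀)
          ≈⟨ +-cong (trans (*-congˡ (recurrence m 2+m≤n)) (zeroʳ _))
                    (+-congˡ (-‿cong (*-congʳ (*-congʳ (C₂-double (suc m)))))) ⟩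
        0# + (two * p₂ * p₁ * e₁ - p₂ * p₁ * (two * q₁) * e₀)
          ≈⟨ +-identityˡ _ ⟩
        two * p₂ * p₁ * e₁ - p₂ * p₁ * (two * q₁) * e₀
          ≈⟨ solve 5 (λ p₁ p₂ q₁ e₀ e₁ → let two = con (+ 2) in
               two :* p₂ :* p₁ :* e₁ :- p₂ :* p₁ :* (two :* q₁) :* e₀
               := p₂ :* p₁ :* (two :* e₁ :- two :* q₁ :* e₀))
             refl p₁ p₂ q₁ e₀ e₁ ⟩
        p₂ * p₁ * (two * e₁ - two * q₁ * e₀) ∎
        where
        q₁ = q (suc m)
        q₂ = q (suc (suc m))
        p₁ = ι (suc m)
        p₂ = ι (suc (suc m))
        γ = C₂ (suc (suc m))
        e₀ = normalised m
        e₁ = normalised (suc m)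

      ClosedForm : ℕ → Set ℓ
      ClosedForm m = normalised m ≈ ι (m !) * ι (U m)

      closedForm₀ : ClosedForm 0
      closedForm₀ = begin
        1# * (χ 0 * q 0)  ≈⟨ *-identityˡ _ ⟩
        χ 0 * q 0         ≈⟨ χq≈1 0 z≤n ⟩
        1#                ≈⟨ solve 0 (con (+ 1) := (con (+ 1) :+ con (+ 0)) :* (con (+ 1) :+ con (+ 0))) refl ⟩
        ι 1 * ι 1         ∎

      closedForm₁ : 1 ≤ n → ClosedForm 1
      closedForm₁ 1≤n = begin
        (- 1# * 1#) * (d 1 * (two * q 1 * q 0))
          ≈⟨ solve 3 (λ d₁ q₁ q₀ → (:- con (+ 1) :* con (+ 1)) :* (d₁ :* (con (+ 2) :* q₁ :* q₀))
                                    := :- (con (+ 2) :* q₀) :* (q₁ :* d₁)) refl (d 1) (q 1) (q 0) ⟩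
        - (two * q 0) * (q 1 * d 1)  ≈⟨ *-congˡ (q₁d₁≈0 1≤n) ⟩
        - (two * q 0) * 0#           ≈⟨ zeroʳ _ ⟩
        0#                           ≈⟨ zeroʳ _ ⟨
        ι 1 * ι 0                    ∎

      closedForm-step : ∀ m → suc (suc m) ≤ n → ClosedForm m → ClosedForm (suc m) → ClosedForm (suc (suc m))
      closedForm-step m 2+m≤n cf₀ cf₁ = begin
        normalised (suc (suc m))
          ≈⟨ normalised-recurrence m 2+m≤n ⟩
        p₂ * p₁ * (two * normalised (suc m) - two * q₁ * normalised m)
          ≈⟨ *-congˡ (+-cong (*-congˡ (trans cf₁ (*-congʳ (ι-homo-* (suc m) (m !))))) (-‿cong (*-congˡ cf₀))) ⟩
        p₂ * p₁ * (two * (p₁ * F₀ * u₁) - two * q₁ * (F₀ * u₀))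
          ≈⟨ solve 6 (λ p₁ p₂ F₀ q₁ u₀ u₁ → let two = con (+ 2) in
               p₂ :* p₁ :* (two :* (p₁ :* F₀ :* u₁) :- two :* q₁ :* (F₀ :* u₀))
               := p₂ :* (p₁ :* F₀) :* (two :* p₁ :* u₁ :- two :* q₁ :* u₀))
             refl p₁ p₂ F₀ q₁ u₀ u₁ ⟩
        p₂ * (p₁ * F₀) * (two * p₁ * u₁ - two * q₁ * u₀)
          ≈⟨ *-cong (trans (ι-homo-* (suc (suc m)) (suc m !)) (*-congˡ (ι-homo-* (suc m) (m !))))
                    (ι-U-recurrence m) ⟨
        ι (suc (suc m) !) * ι (U (suc (suc m))) ∎
        where
        q₁ = q (suc m)
        p₁ = ι (suc m)
        p₂ = ι (suc (suc m))
        F₀ = ι (m !)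
        u₀ = ι (U m)
        u₁ = ι (U (suc m))

      closedForm : ∀ m → m ≤ n → ClosedForm m
      closedForm zero    _     = closedForm₀
      closedForm (suc m) 1+m≤n = proj₂ (consecutive m 1+m≤n)
        where
        consecutive : ∀ m → suc m ≤ n → ClosedForm m × ClosedForm (suc m)
        consecutive zero    1≤n   = closedForm₀ , closedForm₁ 1≤n
        consecutive (suc m) 2+m≤n =
          let (cf₀ , cf₁) = consecutive m (ℕ.<⇒≤ 2+m≤n) in cf₁ , closedForm-step m 2+m≤n cf₀ cf₁

      d≉0 : CharZero → .{{NonZero β}} → 1 < n → ¬ d n ≈ 0#
      d≉0 charZero 1<n dₙ≈0 = charZero (n ! ℕ.* U n) n!Uₙ≢0 (begin
        ι (n ! ℕ.* U n)             ≈⟨ ι-homo-* (n !) (U n) ⟩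
        ι (n !) * ι (U n)           ≈⟨ closedForm n ℕ.≤-refl ⟨
        normalised n                ≈⟨ *-congˡ (trans (*-congʳ dₙ≈0) (zeroˡ _)) ⟩
        (- 1#) ^ n * 0#             ≈⟨ zeroʳ _ ⟩
        0#                          ∎)
        where
        n!Uₙ≢0 : ¬ (n ! ℕ.* U n ≡ 0)
        n!Uₙ≢0 = ℕ.≢-nonZero⁻¹ _ {{ℕ.m*n≢0 (n !) (U n) {{ℕ._!≢0 n}} {{U-nonZero 1<n}}}}

    top-coefficient≉0 : CharZero → .{{NonZero β}} → ∀ {n} → 1 < n → (f : ML n) →
                        (f ⊛ e₂-minus n β) ≋ oneML → ¬ f ⊤ ≈ 0#
    top-coefficient≉0 charZero {n} 1<n f f⊛e₂-β≋1 f⊤≈0 =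
      d≉0 χq≈1 charZero 1<n (trans (sym (top-coefficient n f χ eval≈χ)) f⊤≈0)
      where
      evalf*q≈1 : ∀ x → eval f x * q ∣ x ∣ ≈ 1#
      evalf*q≈1 x = begin
        eval f x * q ∣ x ∣                ≈⟨ *-congˡ (eval-e₂-minus x) ⟨
        eval f x * eval (e₂-minus n β) x  ≈⟨ eval-⊛ f (e₂-minus n β) x ⟨
        eval (f ⊛ e₂-minus n β) x         ≈⟨ eval-cong f⊛e₂-β≋1 x ⟩
        eval oneML x                      ≈⟨ eval-oneML x ⟩
        1#                                ∎
      -- eval f x is the inverse of q ∣ x ∣, so it depends on x only through its weight.
      χ : ℕ → Carrier
      χ k = eval f (initialSegment n k)
      χq≈1 : ∀ k → k ≤ n → χ k * q k ≈ 1#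
      χq≈1 k k≤n = ≡.subst (λ i → χ k * q i ≈ 1#) (∣initialSegment∣ k≤n) (evalf*q≈1 (initialSegment n k))
      eval≈χ : ∀ x → eval f x ≈ χ ∣ x ∣
      eval≈χ x = inverse-unique (evalf*q≈1 x) (χq≈1 ∣ x ∣ (∣p∣≤n x))

lemma4p5 : {c ℓ : Level} (F : Field c ℓ) → FieldOps.CharZero F →
    (n : ℕ) → 1 < n → (β : ℕ) → NonZero β →
    (∀ (x : Fin n → Bool) → ¬ (Field._≈_ F
        (Field._-_ F (FieldOps.e₂-eval F n (λ i → FieldOps.bit F (x i))) (FieldOps.ι F β))
        (Field.0# F))) →
    (f : FieldOps.ML F n) →
    FieldOps._≋_ F (FieldOps._⊛_ F f (FieldOps.e₂-minus F n β)) (FieldOps.oneML F) →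
    FieldOps.HasDegree F f n
lemma4p5 F charZero n 1<n β β≢0 _ f f⊛e₂-β≋1 =
  (⊤ , ∣⊤∣≡n n , top-coefficient≉0 F β charZero {{β≢0}} 1<n f f⊛e₂-β≋1) , λ S _ → ∣p∣≤n S
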